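{- Consider the potential (credit) function defined in the context for \textsc{Rotor-Push} and $\textsc{Opt}$. Whenever $\textsc{Opt}$ performs a single swap of two elements at adjacent nodes of its tree (at cost $1$), while the tree of \textsc{Rotor-Push} and its pointers remain unchanged, the total change of credits satisfies $\sum_{e\in E}\Delta c(e)\le 3\cdot f\cdot 1=12$.
   Context: Two algorithms maintain placements of the same $n$ elements $E$ on complete binary trees of the same shape (root at level $0$): \textsc{Rotor-Push} (Rtr) and an offline algorithm $\textsc{Opt}$. $\ell(e)$ denotes the level of $e$ in Rtr's tree and $\ell^{\mathrm{opt}}(e)$ its level in $\textsc{Opt}$'s tree. Rtr's tree has rotor pointers at non-leaf nodes; the global path $P$ is obtained by following pointers from the root, $P_d$ is its level-$d$ node, $\mathrm{flip}(d)$ toggles pointers at $P_{d'}$ for $d'<d$, and the flip-rank $\mathrm{frnk}(w)$ of a level-$k$ node $w$ is the least number of consecutive $\mathrm{flip}(k)$ operations after which $w$ lies on $P$; $\mathrm{frnk}(e)$ is the flip-rank of the node of Rtr's tree holding $e$. Level-weight: $w^{\mathrm{LEV}}(e)=\ell(e)-2\ell^{\mathrm{opt}}(e)-1$ if $\ell(e)\ge 2\ell^{\mathrm{opt}}(e)+2$, and $0$ otherwise. Flip-rank-weight: $w^{\mathrm{FRNK}}(e)=1-\mathrm{frnk}(e)/2^{\ell(e)}$ if $\ell(e)\ge 2\ell^{\mathrm{opt}}(e)+1$, and $0$ otherwise. Credit: $c(e)=f\cdot(w^{\mathrm{LEV}}(e)+w^{\mathrm{FRNK}}(e))$ with $f=4$.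 $\Delta c(e)$ is the change of $c(e)$ caused by the swap. -}

module Defs where

open import Data.Bool using (Bool; true; false; not; if_then_else_)
import Data.Bool as B
open import Data.Nat using (ℕ; zero; suc; _+_; _*_; _∸_; _^_; _≤?_; _<?_)
open import Data.Nat.Properties using (m^n≢0)
open import Data.Fin using (Fin; toℕ)
import Data.Fin as F
open import Data.Vec using (Vec; []; _∷_; _∷ʳ_; toList)
open import Data.Vec.Properties using (≡-dec)
open import Data.List using (List; _++_; [_])
open import Data.Product using (Σ; ∃-syntax; proj₁; proj₂)
open import Data.Integer using (+_)
open import Data.Rational using (ℚ; 0ℚ; 1ℚ; _/_)
import Data.Rational as Q
open import Relation.Nullary using (yes; no)
open import Relation.Binary.PropositionalEquality using (_≡_)

-- Complete binary tree of depth D (levels 0..D, root at level 0).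
-- A node is its level k ≤ D together with its address: the sequence of
-- k left/right steps (false = left, true = right) from the root.

Node : ℕ → Set
Node D = Σ (Fin (suc D)) (λ k → Vec Bool (toℕ k))

level : ∀ {D} → Node D → ℕ
level u = toℕ (proj₁ u)

address : ∀ {D} → (u : Node D) → Vec Bool (level u)
address u = proj₂ u

IsParent : ∀ {D} → Node D → Node D → Set
IsParent u v = ∃[ b ] (toList (address v) ≡ toList (address u) ++ [ b ])

Adjacent : ∀ {D} → Node D → Node D → Set
Adjacent u v = IsParent u v Data.Sum.⊎ IsParent v u
  where import Data.Sum

-- Rotor pointers: the pointer at the node with address v (of length k);
-- false = points to left child, true = to right child.  (Pointers at
-- leaves/below are never used.)

Ptr : Set
Ptr = (k : ℕ) → Vec Bool k → Bool

P : Ptr → (d : ℕ) → Vec Bool d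
P ptr zero = []
P ptr (suc d) = P ptr d ∷ʳ ptr d (P ptr d)

flip : ℕ → Ptr → Ptr
flip d ptr k v with k <? d | ≡-dec B._≟_ v (P ptr k)
... | yes _ | yes _ = not (ptr k v)
... | _     | _     = ptr k v

frnkSearch : (fuel m k : ℕ) → Vec Bool k → Ptr → ℕ
frnkSearch fuel m k w ptr with ≡-dec B._≟_ (P ptr k) w
frnkSearch fuel m k w ptr | yes _ = m
frnkSearch zero m k w ptr | no _ = m
frnkSearch (suc fuel) m k w ptr | no _ = frnkSearch fuel (suc m) k w (flip k ptr)

-- flip-rank of the level-k node w: least number of consecutive flip(k)
-- operations after which w lies on P.  (Searched among 0..2^k; it is
-- always found since flip(k) cycles through all 2^k level-k nodes.)
frnk : Ptr → (k : ℕ) → Vec Bool k → ℕ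
frnk ptr k w = frnkSearch (2 ^ k) 0 k w ptr

-- Credits.  τ : Rtr's placement, σ : Opt's placement.

f : ℕ
f = 4

ℓ : ∀ {D n} → (Fin n → Node D) → Fin n → ℕ
ℓ τ e = level (τ e)

frnkE : ∀ {D n} → Ptr → (Fin n → Node D) → Fin n → ℕ
frnkE ptr τ e = frnk ptr (level (τ e)) (address (τ e))

nat : ℕ → ℚ
nat m = (+ m) / 1

wLEV : ∀ {D n} → (Fin n → Node D) → (Fin n → Node D) → Fin n → ℚ
wLEV τ σ e with (2 * ℓ σ e + 2) ≤? ℓ τ e
... | yes _ = nat (ℓ τ e ∸ (2 * ℓ σ e + 1))
... | no _  = 0ℚ

wFRNK : ∀ {D n} → Ptr → (Fin n → Node D) → (Fin n → Node D) → Fin n → ℚ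
wFRNK ptr τ σ e with (2 * ℓ σ e + 1) ≤? ℓ τ e
... | yes _ = 1ℚ Q.- _/_ (+ frnkE ptr τ e) (2 ^ ℓ τ e) {{m^n≢0 2 (ℓ τ e)}}
... | no _  = 0ℚ

credit : ∀ {D n} → Ptr → (Fin n → Node D) → (Fin n → Node D) → Fin n → ℚ
credit ptr τ σ e = nat f Q.* (wLEV τ σ e Q.+ wFRNK ptr τ σ e)

swapAt : ∀ {D n} → (Fin n → Node D) → Fin n → Fin n → (Fin n → Node D)
swapAt σ a b e with e F.≟ a | e F.≟ b
... | yes _ | _     = σ b
... | no _  | yes _ = σ a
... | no _  | no _  = σ e

sumE : (n : ℕ) → (Fin n → ℚ) → ℚ
sumE zero g = 0ℚ
sumE (suc n) g = g F.zero Q.+ sumE n (λ i → g (F.suc i))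

-- A swap changes Opt's placement only at the two swapped elements: one of them
-- moves one level up in Opt's tree, the other one level down, while Rtr's levels
-- and flip-ranks stay as they are.  Both weights are antitone in ℓ^opt, so the
-- element moving down loses credit.  For the element moving up, w^LEV grows by at
-- most 2 (ℓ^opt enters doubled) and w^FRNK by at most 1 (it lies in [0,1]), so its
-- credit grows by at most 3f.
module Submission where

open import Defs
open import Algebra.Bundles using (CommutativeMonoid)
import Data.Bool as Bool
open import Data.Fin using (Fin)
import Data.Fin as F
open import Data.Fin.Properties using (suc-injective)
import Data.Integer as ℤ
import Data.Integer.Properties as ℤ
open import Data.List using ([_]; length; _++_)
open import Data.List.Properties using (length-++)
open import Data.Nat using (ℕ; zero; suc; _*_; _∸_; _^_; _≤?_; z≤n)
import Data.Nat as ℕ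
import Data.Nat.Properties as ℕ
open import Data.Nat.Coprimality using (1-coprimeTo)
import Data.Nat.Coprimality as Coprimality
open import Data.Nat.Tactic.RingSolver using (solve-∀)
open import Data.Product using (_,_)
open import Data.Rational using (ℚ; 0ℚ; 1ℚ; mkℚ; _/_; _≤_; _+_; _-_; -_; *≤*)
import Data.Rational as ℚ
open import Data.Rational.Properties
  using ( ≤-refl; ≤-reflexive; ≤-trans; module ≤-Reasoning; normalize-coprime; normalize-nonNeg
        ; /-cong; nonNegative⁻¹; toℚᵘ-cancel-≤; toℚᵘ-fromℚᵘ; neg-antimono-≤
        ; +-assoc; +-identityˡ; +-identityʳ; +-inverseʳ; +-mono-≤; +-monoˡ-≤; +-monoʳ-≤
        ; +-0-commutativeMonoid; *-monoˡ-≤-nonNeg; *-distribˡ-+ )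
open import Data.Rational.Unnormalised using (mkℚᵘ)
import Data.Rational.Unnormalised as ℚᵘ
import Data.Rational.Unnormalised.Properties as ℚᵘ
open import Data.Sum using (inj₁; inj₂)
open import Data.Vec using (toList)
open import Data.Vec.Properties using (length-toList; ≡-dec)
open import Function using (_∘_)
open import Function.Definitions using (Bijective)
open import Relation.Nullary using (yes; no)
open import Relation.Nullary.Negation using (contradiction)
open import Relation.Binary.PropositionalEquality
  using (_≡_; _≢_; refl; sym; trans; cong; cong₂; subst; subst₂; module ≡-Reasoning)
open import Algebra.Properties.CommutativeSemigroup
  (CommutativeMonoid.commutativeSemigroup +-0-commutativeMonoid) using (interchange)

nat≡mkℚ : ∀ m → nat m ≡ mkℚ (ℤ.+ m) 0 (Coprimality.sym (1-coprimeTo m))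
nat≡mkℚ m = normalize-coprime (Coprimality.sym (1-coprimeTo m))

nat-mono-≤ : ∀ {m n} → m ℕ.≤ n → nat m ≤ nat n
nat-mono-≤ {m} {n} m≤n rewrite nat≡mkℚ m | nat≡mkℚ n =
  *≤* (subst₂ ℤ._≤_ (sym (ℤ.*-identityʳ (ℤ.+ m))) (sym (ℤ.*-identityʳ (ℤ.+ n))) (ℤ.+≤+ m≤n))

nat-+ : ∀ m n → nat (m ℕ.+ n) ≡ nat m + nat n
nat-+ m n rewrite nat≡mkℚ m | nat≡mkℚ n =
  /-cong (sym (cong₂ ℤ._+_ (ℤ.*-identityʳ (ℤ.+ m)) (ℤ.*-identityʳ (ℤ.+ n)))) refl

0≤nat : ∀ m → 0ℚ ≤ nat m
0≤nat m = nat-mono-≤ {0} {m} z≤n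

0≤m/n : ∀ m n .{{_ : ℕ.NonZero n}} → 0ℚ ≤ (ℤ.+ m) / n
0≤m/n m n = nonNegative⁻¹ _ {{normalize-nonNeg m n}}

m/n≤1 : ∀ m n .{{_ : ℕ.NonZero n}} → m ℕ.≤ n → (ℤ.+ m) / n ≤ 1ℚ
m/n≤1 m (suc n) m≤n = toℚᵘ-cancel-≤ (ℚᵘ.≤-trans
  (ℚᵘ.≤-reflexive (toℚᵘ-fromℚᵘ (mkℚᵘ (ℤ.+ m) n)))
  (ℚᵘ.*≤* (subst₂ ℤ._≤_ (sym (ℤ.*-identityʳ (ℤ.+ m))) (sym (ℤ.*-identityˡ (ℤ.+ suc n))) (ℤ.+≤+ m≤n))))

p≤q+p : ∀ {p q} → 0ℚ ≤ q → p ≤ q + p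
p≤q+p {p} {q} 0≤q = begin
  p       ≡⟨ sym (+-identityˡ p) ⟩
  0ℚ + p  ≤⟨ +-monoˡ-≤ p 0≤q ⟩
  q + p   ∎
  where open ≤-Reasoning

p≤r+q⇒p-q≤r : ∀ {p q r} → p ≤ r + q → p - q ≤ r
p≤r+q⇒p-q≤r {p} {q} {r} p≤r+q = begin
  p - q             ≤⟨ +-monoˡ-≤ (- q) p≤r+q ⟩
  (r + q) - q       ≡⟨ +-assoc r q (- q) ⟩
  r + (q - q)       ≡⟨ cong (r +_) (+-inverseʳ q) ⟩
  r + 0ℚ            ≡⟨ +-identityʳ r ⟩
  r                 ∎
  where open ≤-Reasoning

p≤q⇒p-q≤0 : ∀ {p q} → p ≤ q → p - q ≤ 0ℚ
p≤q⇒p-q≤0 {p} {q} p≤q = p≤r+q⇒p-q≤r (≤-trans p≤q (≤-reflexive (sym (+-identityˡ q))))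

p≤1⇒0≤1-p : ∀ {p} → p ≤ 1ℚ → 0ℚ ≤ 1ℚ - p
p≤1⇒0≤1-p {p} p≤1 = begin
  0ℚ      ≡⟨ sym (+-inverseʳ p) ⟩
  p - p   ≤⟨ +-monoˡ-≤ (- p) p≤1 ⟩
  1ℚ - p  ∎
  where open ≤-Reasoning

0≤p⇒1-p≤1 : ∀ {p} → 0ℚ ≤ p → 1ℚ - p ≤ 1ℚ
0≤p⇒1-p≤1 {p} 0≤p = begin
  1ℚ - p   ≤⟨ +-monoʳ-≤ 1ℚ (neg-antimono-≤ 0≤p) ⟩
  1ℚ - 0ℚ  ≡⟨ +-identityʳ 1ℚ ⟩
  1ℚ       ∎
  where open ≤-Reasoning

frnkSearch≤ : ∀ fuel m k w ptr → frnkSearch fuel m k w ptr ℕ.≤ m ℕ.+ fuel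
frnkSearch≤ fuel m k w ptr with ≡-dec Bool._≟_ (P ptr k) w
frnkSearch≤ fuel       m k w ptr | yes _ = ℕ.m≤m+n m fuel
frnkSearch≤ zero       m k w ptr | no _  = ℕ.m≤m+n m 0
frnkSearch≤ (suc fuel) m k w ptr | no _  =
  ℕ.≤-trans (frnkSearch≤ fuel (suc m) k w (flip k ptr)) (ℕ.≤-reflexive (sym (ℕ.+-suc m fuel)))

frnk≤2^ : ∀ ptr k w → frnk ptr k w ℕ.≤ 2 ^ k
frnk≤2^ ptr k w = frnkSearch≤ (2 ^ k) 0 k w ptr

-- Below its threshold w^LEV vanishes, and so does the truncated difference.
wLEV≡nat∸ : ∀ {D n} (τ σ : Fin n → Node D) e → wLEV τ σ e ≡ nat (ℓ τ e ∸ (2 * ℓ σ e ℕ.+ 1))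
wLEV≡nat∸ τ σ e with (2 * ℓ σ e ℕ.+ 2) ≤? ℓ τ e
... | yes _ = refl
... | no ≰ = cong nat (sym (ℕ.m≤n⇒m∸n≡0 ℓτ≤2ℓσ+1))
  where
  ℓτ≤2ℓσ+1 : ℓ τ e ℕ.≤ 2 * ℓ σ e ℕ.+ 1
  ℓτ≤2ℓσ+1 = ℕ.m<1+n⇒m≤n (subst (ℓ τ e ℕ.<_) (ℕ.+-suc (2 * ℓ σ e) 1) (ℕ.≰⇒> ≰))

2m+1≤2n+1 : ∀ {m n} → m ℕ.≤ n → 2 * m ℕ.+ 1 ℕ.≤ 2 * n ℕ.+ 1
2m+1≤2n+1 m≤n = ℕ.+-monoˡ-≤ 1 (ℕ.*-monoʳ-≤ 2 m≤n)

m≡1+n⇒n≤m : ∀ {m n} → m ≡ suc n → n ℕ.≤ m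
m≡1+n⇒n≤m {n = n} m≡1+n = subst (n ℕ.≤_) (sym m≡1+n) (ℕ.n≤1+n n)

2n+1+2≡2[1+n]+1 : ∀ n → 2 * n ℕ.+ 1 ℕ.+ 2 ≡ 2 * suc n ℕ.+ 1
2n+1+2≡2[1+n]+1 = solve-∀

m∸[2n+1]≤2+m∸[2[1+n]+1] : ∀ m n → m ∸ (2 * n ℕ.+ 1) ℕ.≤ 2 ℕ.+ (m ∸ (2 * suc n ℕ.+ 1))
m∸[2n+1]≤2+m∸[2[1+n]+1] m n = ℕ.≤-trans (ℕ.m≤n+m∸n (m ∸ (2 * n ℕ.+ 1)) 2)
  (ℕ.≤-reflexive (cong (2 ℕ.+_) (trans (ℕ.∸-+-assoc m (2 * n ℕ.+ 1) 2) (cong (m ∸_) (2n+1+2≡2[1+n]+1 n)))))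

wLEV-antitone : ∀ {D n} (τ σ σ′ : Fin n → Node D) e → ℓ σ e ℕ.≤ ℓ σ′ e →
  wLEV τ σ′ e ≤ wLEV τ σ e
wLEV-antitone τ σ σ′ e ℓσ≤ℓσ′ rewrite wLEV≡nat∸ τ σ e | wLEV≡nat∸ τ σ′ e =
  nat-mono-≤ (ℕ.∸-monoʳ-≤ (ℓ τ e) (2m+1≤2n+1 ℓσ≤ℓσ′))

wLEV-raise : ∀ {D n} (τ σ σ′ : Fin n → Node D) e → ℓ σ e ≡ suc (ℓ σ′ e) →
  wLEV τ σ′ e ≤ nat 2 + wLEV τ σ e
wLEV-raise τ σ σ′ e ℓσ≡ rewrite wLEV≡nat∸ τ σ e | wLEV≡nat∸ τ σ′ e | ℓσ≡ =
  ≤-trans (nat-mono-≤ (m∸[2n+1]≤2+m∸[2[1+n]+1] (ℓ τ e) (ℓ σ′ e)))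
          (≤-reflexive (nat-+ 2 (ℓ τ e ∸ (2 * suc (ℓ σ′ e) ℕ.+ 1))))

module _ {D n : ℕ} (ptr : Ptr) (τ σ σ′ : Fin n → Node D) (e : Fin n) where

  wFRNK-antitone : ℓ σ e ℕ.≤ ℓ σ′ e → wFRNK ptr τ σ′ e ≤ wFRNK ptr τ σ e
  wFRNK-antitone ℓσ≤ℓσ′ with (2 * ℓ σ′ e ℕ.+ 1) ≤? ℓ τ e | (2 * ℓ σ e ℕ.+ 1) ≤? ℓ τ e
  ... | yes _ | yes _ = ≤-refl
  ... | yes ≤ℓ | no ≰ℓ = contradiction (ℕ.≤-trans (2m+1≤2n+1 ℓσ≤ℓσ′) ≤ℓ) ≰ℓ
  ... | no _ | yes _ = p≤1⇒0≤1-p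
    (m/n≤1 (frnkE ptr τ e) (2 ^ ℓ τ e) {{ℕ.m^n≢0 2 (ℓ τ e)}} (frnk≤2^ ptr (ℓ τ e) (address (τ e))))
  ... | no _ | no _ = ≤-refl

  wFRNK-raise : ℓ σ e ≡ suc (ℓ σ′ e) → wFRNK ptr τ σ′ e ≤ 1ℚ + wFRNK ptr τ σ e
  wFRNK-raise ℓσ≡ with (2 * ℓ σ′ e ℕ.+ 1) ≤? ℓ τ e | (2 * ℓ σ e ℕ.+ 1) ≤? ℓ τ e
  ... | yes _ | yes _ = p≤q+p (0≤nat 1)
  ... | yes _ | no _ = ≤-trans
    (0≤p⇒1-p≤1 (0≤m/n (frnkE ptr τ e) (2 ^ ℓ τ e) {{ℕ.m^n≢0 2 (ℓ τ e)}}))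
    (≤-reflexive (sym (+-identityʳ 1ℚ)))
  ... | no ≰ℓ | yes ≤ℓ = contradiction (ℕ.≤-trans (2m+1≤2n+1 (m≡1+n⇒n≤m ℓσ≡)) ≤ℓ) ≰ℓ
  ... | no _ | no _ = p≤q+p (0≤nat 1)

  credit-antitone : ℓ σ e ℕ.≤ ℓ σ′ e → credit ptr τ σ′ e ≤ credit ptr τ σ e
  credit-antitone ℓσ≤ℓσ′ =
    *-monoˡ-≤-nonNeg (nat f) (+-mono-≤ (wLEV-antitone τ σ σ′ e ℓσ≤ℓσ′) (wFRNK-antitone ℓσ≤ℓσ′))

  credit-raise : ℓ σ e ≡ suc (ℓ σ′ e) → credit ptr τ σ′ e ≤ nat (3 * f) + credit ptr τ σ e
  credit-raise ℓσ≡ = begin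
    nat f ℚ.* (wLEV τ σ′ e + wFRNK ptr τ σ′ e)
      ≤⟨ *-monoˡ-≤-nonNeg (nat f) (+-mono-≤ (wLEV-raise τ σ σ′ e ℓσ≡) (wFRNK-raise ℓσ≡)) ⟩
    nat f ℚ.* ((nat 2 + wLEV τ σ e) + (1ℚ + wFRNK ptr τ σ e))
      ≡⟨ cong (nat f ℚ.*_) (interchange (nat 2) (wLEV τ σ e) 1ℚ (wFRNK ptr τ σ e)) ⟩
    nat f ℚ.* ((nat 2 + 1ℚ) + (wLEV τ σ e + wFRNK ptr τ σ e))
      ≡⟨ *-distribˡ-+ (nat f) (nat 2 + 1ℚ) (wLEV τ σ e + wFRNK ptr τ σ e) ⟩
    nat (3 * f) + credit ptr τ σ e
      ∎
    where open ≤-Reasoning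

sumE-≤-0 : ∀ n (g : Fin n → ℚ) → (∀ e → g e ≤ 0ℚ) → sumE n g ≤ 0ℚ
sumE-≤-0 zero    g _   = ≤-refl
sumE-≤-0 (suc n) g g≤0 = +-mono-≤ (g≤0 F.zero) (sumE-≤-0 n (g ∘ F.suc) (g≤0 ∘ F.suc))

sumE-≤-single : ∀ n (g : Fin n → ℚ) x {c} → g x ≤ c → (∀ e → e ≢ x → g e ≤ 0ℚ) → sumE n g ≤ c
sumE-≤-single (suc n) g F.zero {c} gx≤c g≤0 = begin
  g F.zero + sumE n (g ∘ F.suc)  ≤⟨ +-mono-≤ gx≤c (sumE-≤-0 n (g ∘ F.suc) (λ e → g≤0 (F.suc e) λ ())) ⟩
  c + 0ℚ                        ≡⟨ +-identityʳ c ⟩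
  c                             ∎
  where open ≤-Reasoning
sumE-≤-single (suc n) g (F.suc x) {c} gx≤c g≤0 = begin
  g F.zero + sumE n (g ∘ F.suc)  ≤⟨ +-mono-≤ (g≤0 F.zero λ ()) tail≤c ⟩
  0ℚ + c                        ≡⟨ +-identityˡ c ⟩
  c                             ∎
  where
  open ≤-Reasoning
  tail≤c : sumE n (g ∘ F.suc) ≤ c
  tail≤c = sumE-≤-single n (g ∘ F.suc) x gx≤c (λ e e≢x → g≤0 (F.suc e) (e≢x ∘ suc-injective))

sumE-Δcredit≤3f : ∀ {D n} ptr (τ σ σ′ : Fin n → Node D) x → ℓ σ x ≡ suc (ℓ σ′ x) →
  (∀ e → e ≢ x → ℓ σ e ℕ.≤ ℓ σ′ e) → sumE n (λ e → credit ptr τ σ′ e - credit ptr τ σ e) ≤ nat (3 * f)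
sumE-Δcredit≤3f {n = n} ptr τ σ σ′ x ℓσx≡ ℓσ≤ℓσ′ = sumE-≤-single n _ x
  (p≤r+q⇒p-q≤r (credit-raise ptr τ σ σ′ x ℓσx≡))
  (λ e e≢x → p≤q⇒p-q≤0 (credit-antitone ptr τ σ σ′ e (ℓσ≤ℓσ′ e e≢x)))

IsParent⇒level≡suc : ∀ {D} {u v : Node D} → IsParent u v → level v ≡ suc (level u)
IsParent⇒level≡suc {u = u} {v} (b , v≡u∷ʳb) = begin
  level v                               ≡⟨ sym (length-toList (address v)) ⟩
  length (toList (address v))           ≡⟨ cong length v≡u∷ʳb ⟩
  length (toList (address u) ++ [ b ])  ≡⟨ length-++ (toList (address u)) ⟩
  length (toList (address u)) ℕ.+ 1    ≡⟨ cong (ℕ._+ 1) (length-toList (address u)) ⟩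
  level u ℕ.+ 1                         ≡⟨ ℕ.+-comm (level u) 1 ⟩
  suc (level u)                         ∎
  where open ≡-Reasoning

module _ {D n : ℕ} (σ : Fin n → Node D) (a b : Fin n) where

  swapAt-at₁ : swapAt σ a b a ≡ σ b
  swapAt-at₁ with a F.≟ a
  ... | yes _   = refl
  ... | no a≢a  = contradiction refl a≢a

  swapAt-at₂ : swapAt σ a b b ≡ σ a
  swapAt-at₂ with b F.≟ a | b F.≟ b
  ... | yes b≡a | _       = cong σ b≡a
  ... | no _    | yes _   = refl
  ... | no _    | no b≢b  = contradiction refl b≢b

  level-≤-swapAt-except₂ : level (σ a) ℕ.≤ level (σ b) → ∀ e → e ≢ b → level (σ e) ℕ.≤ level (swapAt σ a b e)
  level-≤-swapAt-except₂ σa≤σb e e≢b with e F.≟ a | e F.≟ b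
  ... | yes refl | _       = σa≤σb
  ... | no _     | yes e≡b = contradiction e≡b e≢b
  ... | no _     | no _    = ℕ.≤-refl

  level-≤-swapAt-except₁ : level (σ b) ℕ.≤ level (σ a) → ∀ e → e ≢ a → level (σ e) ℕ.≤ level (swapAt σ a b e)
  level-≤-swapAt-except₁ σb≤σa e e≢a with e F.≟ a | e F.≟ b
  ... | yes e≡a | _        = contradiction e≡a e≢a
  ... | no _    | yes refl = σb≤σa
  ... | no _    | no _     = ℕ.≤-refl

lemma4 : (D n : ℕ) (τ σ : Fin n → Node D) → Bijective _≡_ _≡_ τ → Bijective _≡_ _≡_ σ →
    (ptr : Ptr) (a b : Fin n) → Adjacent (σ a) (σ b) →
    sumE n (λ e → credit ptr τ (swapAt σ a b) e - credit ptr τ σ e) ≤ nat (3 * f * 1)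
lemma4 D n τ σ _ _ ptr a b (inj₁ σa-parent) =
  sumE-Δcredit≤3f ptr τ σ (swapAt σ a b) b
    (trans σb≡1+σa (cong (suc ∘ level) (sym (swapAt-at₂ σ a b))))
    (level-≤-swapAt-except₂ σ a b (m≡1+n⇒n≤m σb≡1+σa))
  where
  σb≡1+σa : level (σ b) ≡ suc (level (σ a))
  σb≡1+σa = IsParent⇒level≡suc σa-parent
lemma4 D n τ σ _ _ ptr a b (inj₂ σb-parent) =
  sumE-Δcredit≤3f ptr τ σ (swapAt σ a b) a
    (trans σa≡1+σb (cong (suc ∘ level) (sym (swapAt-at₁ σ a b))))
    (level-≤-swapAt-except₁ σ a b (m≡1+n⇒n≤m σa≡1+σb))
  where
  σa≡1+σb : level (σ a) ≡ suc (level (σ b))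
  σa≡1+σb = IsParent⇒level≡suc σb-parent
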